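{- Let $\mathcal{L}$ be a library, $\Gamma$ a method specification, and suppose $\mathcal{L}:\Gamma$ is safe at $\sigma_0$. Consider traces $\zeta=\zeta_1\,(t_2,\mathsf{ret}\ m_2(\sigma_2))\,(t_1,\mathsf{call}\ m_1(\sigma_1))\,\zeta_2\in[\![\mathcal{L}:\Gamma]\!]\sigma_0$ and $\zeta'=\zeta_1\,(t_1,\mathsf{call}\ m_1(\sigma_1))\,(t_2,\mathsf{ret}\ m_2(\sigma_2))\,\zeta_2$. If $\mathsf{history}(\zeta')$ is balanced from $\delta(\sigma_0)$, then $\zeta'\in[\![\mathcal{L}:\Gamma]\!]\sigma_0$.
   Context: Separation algebra: a set $\Sigma$ with a partial commutative, associative (both sides defined and equal or both undefined), cancellative binary operation $*$ with unit $e$; $(\sigma_1*\sigma_2)\downarrow$ means defined; $\sigma_2\setminus\sigma_1$ is the unique $\sigma$ with $\sigma_2=\sigma*\sigma_1$. Footprint $\delta(\sigma)=\{\sigma'\mid\forall\sigma''.(\sigma'*\sigma'')\downarrow\iff(\sigma*\sigma'')\downarrow\}$; $\delta(\sigma_1)\circ\delta(\sigma_2)=\delta(\sigma_1*\sigma_2)$ if defined. Standing assumption: $*$ is cancellative on footprints (if $\sigma_1*\sigma_2,\sigma_1'*\sigma_2'$ defined, $\delta(\sigma_1*\sigma_2)=\delta(\sigma_1'*\sigma_2')$ and $\delta(\sigma_1)=\delta(\sigma_1')$ imply $\delta(\sigma_2)=\delta(\sigma_2')$). $l_2\mathbin{\backslash\!\backslash}l_1=\delta(\sigma)$ if $l_1=\delta(\sigma_1),l_2=\delta(\sigma_2),\sigma_2=\sigma_1*\sigma$.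 Histories: finite sequences of interface actions $(t,\mathsf{call}\,m(\sigma))$, $(t,\mathsf{ret}\,m(\sigma))$ (per thread alternating calls/returns of matching methods starting with a call). $H$ is balanced from $l$ if $[\![H]\!]^\sharp l$ is defined, where $[\![\varepsilon]\!]^\sharp l=l$, $[\![H\psi]\!]^\sharp l=([\![H]\!]^\sharp l)\circ\delta(\sigma)$ for a call carrying $\sigma$ and $([\![H]\!]^\sharp l)\mathbin{\backslash\!\backslash}\delta(\sigma)$ for a return carrying $\sigma$. Primitive commands have transformers $f^t_c:\Sigma\to\mathcal{P}(\Sigma)\cup\{\top\}$ satisfying Footprint Preservation ($\sigma'\in f^t_c(\sigma)\Rightarrow\delta(\sigma')=\delta(\sigma)$) and Strong Locality ($(\sigma_1*\sigma_2)\downarrow$, $f^t_c(\sigma_1)\ne\top$ imply $f^t_c(\sigma_1*\sigma_2)=\{\sigma'*\sigma_2\mid\sigma'\in f^t_c(\sigma_1)\}$). Library $\mathcal{L}=\{m=C_m\mid m\in M\}$ with bodies $C::=c\mid C;C\mid C+C\mid C^*$. Precise predicate $r$: each $\sigma$ has at most one $\sigma_1\in r$ with $\sigma=\sigma_1*\sigma_2$; $\sigma\setminus r=\sigma_2$. Method specification: triples $\{p\}m\{q\}$ (at most one per method), $p,q$ maps from threads to precise predicates. Library-local semantics $[\![\mathcal{L}:\Gamma]\!]\sigma$: trace set = prefix closure of the union over $k\ge1$ of all interleavings of $k$ threads, each thread $t$ finitely often producing $(t,\mathsf{call}\,m)\,\tau\,(t,\mathsf{ret}\,m)$ with $\tau$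 a sequence of $(t,c)$ actions generated by $C_m$ ($[c]_t=\{(t,c)\}$, union, concatenation, Kleene star). Evaluation: $(t,c)$ gives $\top$ if $f^t_c(\sigma)=\top$ else $\{(\sigma',(t,c))\mid\sigma'\in f^t_c(\sigma)\}$; for $\{p\}m\{q\}\in\Gamma$, $(t,\mathsf{call}\,m)$ gives $\{(\sigma*\sigma_p,(t,\mathsf{call}\,m(\sigma_p)))\mid\sigma_p\in p_t,(\sigma*\sigma_p)\downarrow\}$, $(t,\mathsf{ret}\,m)$ gives $\top$ if $\sigma\setminus q_t$ undefined else $\{(\sigma\setminus q_t,(t,\mathsf{ret}\,m(\sigma_q)))\}$ with $\sigma_q\in q_t$ the unique substate. Traces are evaluated step by step ($\top$ propagates). $[\![\mathcal{L}:\Gamma]\!]\sigma=\top$ if some trace evaluates to $\top$ from $\sigma$, else the set of resulting annotated traces; safe at $\sigma$ iff $\ne\top$. $\mathsf{history}$ = subsequence of call/return actions. -}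

module Defs where

open import Data.Maybe using (Maybe; just; nothing; _>>=_; Is-just)
open import Data.List using (List; []; _∷_; _++_; map; filter)
open import Data.Product using (Σ; ∃; ∃₂; _×_; _,_)
open import Data.Empty using (⊥)
open import Data.Unit using (⊤)
open import Relation.Nullary using (¬_; Dec; yes; no)
open import Relation.Binary.PropositionalEquality using (_≡_; _≢_)
open import Relation.Binary.Definitions using (DecidableEquality)
open import Function.Bundles using (_⇔_)

-- Separation algebras.  The partial operation * is  _⊙_ : St → St → Maybe St
-- ((σ₁ * σ₂)↓  ⇔  Is-just (σ₁ ⊙ σ₂)).

record SepAlg : Set₁ where
  field
    St     : Set
    _⊙_    : St → St → Maybe St
    e      : St
    comm   : ∀ a b → a ⊙ b ≡ b ⊙ a
    -- both sides defined and equal, or both undefined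
    assoc  : ∀ a b c → ((a ⊙ b) >>= λ ab → ab ⊙ c) ≡ ((b ⊙ c) >>= λ bc → a ⊙ bc)
    unit   : ∀ a → e ⊙ a ≡ just a
    cancel : ∀ a b c s → a ⊙ b ≡ just s → a ⊙ c ≡ just s → b ≡ c

module SA-Defs (SA : SepAlg) where
  open SepAlg SA

  Pred : Set₁
  Pred = St → Set

  _≐_ : Pred → Pred → Set
  P ≐ Q = ∀ x → P x ⇔ Q x

  δ : St → Pred
  δ σ σ' = ∀ σ'' → Is-just (σ' ⊙ σ'') ⇔ Is-just (σ ⊙ σ'')

  FpCancellative : Set
  FpCancellative = ∀ a b ab a' b' ab' → a ⊙ b ≡ just ab → a' ⊙ b' ≡ just ab' →
                   δ ab ≐ δ ab' → δ a ≐ δ a' → δ b ≐ δ b'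

  Precise : Pred → Set
  Precise r = ∀ σ a b a' b' → r a → r a' → a ⊙ b ≡ just σ → a' ⊙ b' ≡ just σ → a ≡ a'

  -- l ∘ δ(σ) = l'  (l = δ(σ₁), δ(σ) = δ(σ₂), l' = δ(σ₁ * σ₂))
  FpCompose : Pred → St → Pred → Set
  FpCompose l σ l' = Σ St λ σ₁ → Σ St λ σ₂ → Σ St λ s →
    (l ≐ δ σ₁) × (δ σ ≐ δ σ₂) × (σ₁ ⊙ σ₂ ≡ just s) × (l' ≐ δ s)

  -- l \\ δ(σ) = l'  (δ(σ) = δ(σ₁), l = δ(σ₂), σ₂ = σ₁ * s, l' = δ(s))
  FpMinus : Pred → St → Pred → Set
  FpMinus l σ l' = Σ St λ σ₁ → Σ St λ σ₂ → Σ St λ s →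
    (δ σ ≐ δ σ₁) × (l ≐ δ σ₂) × (σ₁ ⊙ s ≡ just σ₂) × (l' ≐ δ s)

data Outcome (A : Set) : Set₁ where
  fault : Outcome A             -- ⊤
  outs  : (A → Set) → Outcome A

_∈out_ : {A : Set} → A → Outcome A → Set
x ∈out fault  = ⊥
x ∈out outs P = P x

IsFault : {A : Set} → Outcome A → Set
IsFault fault    = ⊤
IsFault (outs _) = ⊥

record Prims (SA : SepAlg) (T : Set) : Set₁ where
  open SepAlg SA
  open SA-Defs SA
  field
    Cmd : Set
    f   : T → Cmd → St → Outcome St
    fp-pres   : ∀ t c σ P σ' → f t c σ ≡ outs P → P σ' → δ σ' ≐ δ σ
    strong-loc : ∀ t c σ₁ σ₂ σ₁₂ Q → σ₁ ⊙ σ₂ ≡ just σ₁₂ → f t c σ₁ ≡ outs Q →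
                 Σ (St → Set) λ P → (f t c σ₁₂ ≡ outs P) ×
                   (∀ x → P x ⇔ (Σ St λ σ' → Q σ' × (σ' ⊙ σ₂ ≡ just x)))

data Com (C : Set) : Set where
  prim : C → Com C
  _；_  : Com C → Com C → Com C
  _⊕_  : Com C → Com C → Com C
  _⋆   : Com C → Com C

data Gen {C : Set} : Com C → List C → Set where
  g-prim : ∀ c → Gen (prim c) (c ∷ [])
  g-seq  : ∀ {C₁ C₂ xs ys} → Gen C₁ xs → Gen C₂ ys → Gen (C₁ ； C₂) (xs ++ ys)
  g-inl  : ∀ {C₁ C₂ xs} → Gen C₁ xs → Gen (C₁ ⊕ C₂) xs
  g-inr  : ∀ {C₁ C₂ xs} → Gen C₂ xs → Gen (C₁ ⊕ C₂) xs
  g-nil  : ∀ {C₁} → Gen (C₁ ⋆) []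
  g-more : ∀ {C₁ xs ys} → Gen C₁ xs → Gen (C₁ ⋆) ys → Gen (C₁ ⋆) (xs ++ ys)

record Triple (SA : SepAlg) (T : Set) : Set₁ where
  open SepAlg SA
  open SA-Defs SA
  field
    pre      : T → St → Set
    post     : T → St → Set
    pre-pr   : ∀ t → Precise (pre t)
    post-pr  : ∀ t → Precise (post t)

module Semantics (SA : SepAlg) (T : Set) (_≟T_ : DecidableEquality T) (M : Set)
                 (PC : Prims SA T) (L : M → Com (Prims.Cmd PC))
                 (Γ : M → Triple SA T) where
  open SepAlg SA
  open SA-Defs SA
  open Prims PC
  open Triple

  data Act : Set where
    cmd  : T → Cmd → Act
    call : T → M → Act
    ret  : T → M → Act

  data AAct : Set where
    acmd  : T → Cmd → AAct
    acall : T → M → St → AAct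
    aret  : T → M → St → AAct

  data HAct : Set where
    hcall : T → M → St → HAct
    hret  : T → M → St → HAct

  thr : Act → T
  thr (cmd t _)  = t
  thr (call t _) = t
  thr (ret t _)  = t

  proj : T → List Act → List Act
  proj t = filter (λ a → thr a ≟T t)

  data Blocks (t : T) : List Act → Set where
    b-nil  : Blocks t []
    b-cons : ∀ {m cs rest} → Gen (L m) cs → Blocks t rest →
             Blocks t ((call t m ∷ map (cmd t) cs) ++ (ret t m ∷ rest))

  -- trace set: prefix closure of the interleavings of threads
  Trace : List Act → Set
  Trace τ = Σ (List Act) λ τ' → Σ (List Act) λ s → (τ ++ s ≡ τ') × (∀ t → Blocks t (proj t τ'))

  data Step : St → Act → St → AAct → Set where
    s-cmd  : ∀ {σ σ' t c} → σ' ∈out f t c σ → Step σ (cmd t c) σ' (acmd t c)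
    s-call : ∀ {σ σ' t m σp} → pre (Γ m) t σp → σ ⊙ σp ≡ just σ' →
             Step σ (call t m) σ' (acall t m σp)
    s-ret  : ∀ {σ σ' t m σq} → post (Γ m) t σq → σq ⊙ σ' ≡ just σ →
             Step σ (ret t m) σ' (aret t m σq)

  data StepFault : St → Act → Set where
    f-cmd : ∀ {σ t c} → IsFault (f t c σ) → StepFault σ (cmd t c)
    f-ret : ∀ {σ t m} → ¬ (Σ St λ σq → Σ St λ σ' → post (Γ m) t σq × (σq ⊙ σ' ≡ just σ)) →
            StepFault σ (ret t m)

  data Run : St → List Act → List AAct → St → Set where
    r-nil  : ∀ {σ} → Run σ [] [] σ
    r-cons : ∀ {σ σ' σ'' a b τ ζ} → Step σ a σ' b → Run σ' τ ζ σ'' → Run σ (a ∷ τ) (b ∷ ζ) σ''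

  data Faults : St → List Act → Set where
    fl-now   : ∀ {σ a τ} → StepFault σ a → Faults σ (a ∷ τ)
    fl-later : ∀ {σ σ' a b τ} → Step σ a σ' b → Faults σ' τ → Faults σ (a ∷ τ)

  Safe : St → Set
  Safe σ = ∀ τ → Trace τ → ¬ Faults σ τ

  InSem : St → List AAct → Set
  InSem σ ζ = Σ (List Act) λ τ → Σ St λ σ' → Trace τ × Run σ τ ζ σ'

  history : List AAct → List HAct
  history []                 = []
  history (acmd _ _ ∷ ζ)     = history ζ
  history (acall t m σ ∷ ζ)  = hcall t m σ ∷ history ζ
  history (aret t m σ ∷ ζ)   = hret t m σ ∷ history ζ

  hthr : HAct → T
  hthr (hcall t _ _) = t
  hthr (hret t _ _)  = t

  hproj : T → List HAct → List HAct
  hproj t = filter (λ a → hthr a ≟T t)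

  data ThreadWF (t : T) : List HAct → Set where
    w-nil     : ThreadWF t []
    w-pending : ∀ {m σ} → ThreadWF t (hcall t m σ ∷ [])
    w-cons    : ∀ {m σ σ' H} → ThreadWF t H → ThreadWF t (hcall t m σ ∷ hret t m σ' ∷ H)

  IsHistory : List HAct → Set
  IsHistory H = ∀ t → ThreadWF t (hproj t H)

  -- [[H]]♯ l = l'  (evaluated left to right, equivalent to the snoc recursion)
  data FpEval : List HAct → Pred → Pred → Set₁ where
    fe-nil  : ∀ {l} → FpEval [] l l
    fe-call : ∀ {l l' l'' t m σ H} → FpCompose l σ l' → FpEval H l' l'' →
              FpEval (hcall t m σ ∷ H) l l''
    fe-ret  : ∀ {l l' l'' t m σ H} → FpMinus l σ l' → FpEval H l' l'' →
              FpEval (hret t m σ ∷ H) l l''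

  BalancedFrom : List HAct → Pred → Set₁
  BalancedFrom H l = Σ Pred λ l' → FpEval H l l'

-- Let ρ be the state reached after ζ₁. In ζ the return splits ρ = σ₂ * ρ' and the call
-- then forms ρ'' = ρ' * σ₁. If ρ * σ₁ is defined, associativity gives ρ * σ₁ = σ₂ * ρ'', so
-- the call and the return can be taken in the other order and still reach ρ''. Definedness of
-- ρ * σ₁ comes from balancedness: along any run the abstract evaluation [[H]]♯ tracks the
-- footprint of the concrete state (commands preserve footprints, calls compose them and returns
-- cancel them by cancellativity on footprints), and [[H]]♯ performs the composition with δ(σ₁).
-- Finally the two actions belong to different threads: a thread is inside a method before a
-- return in a trace but outside one before a call in a history, and the prefixes agree. Swapping
-- adjacent actions of different threads preserves every thread projection, hence the trace set.
module Submission where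

open import Defs
open import Data.List using (List; []; _∷_; [_]; _++_; map)
open import Data.List.Properties using (++-assoc; filter-++; filter-accept)
open import Data.Maybe using (Maybe; just; nothing; _>>=_; Is-just)
open import Data.Maybe.Properties using (just-injective)
open import Data.Maybe.Relation.Unary.Any using (just)
open import Data.Product using (∃; _×_; _,_)
open import Data.Empty using (⊥-elim)
open import Data.Unit using (tt)
open import Function using (_∘_)
open import Function.Bundles using (_⇔_; mk⇔; Equivalence)
open import Function.Construct.Identity using (⇔-id)
open import Function.Construct.Symmetry using (⇔-sym)
open import Function.Construct.Composition using (_⇔-∘_)
open import Relation.Nullary using (yes; no)
open import Relation.Binary.Definitions using (DecidableEquality)
open import Relation.Binary.PropositionalEquality using (_≡_; _≢_; refl; sym; trans; cong; subst; module ≡-Reasoning)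
open ≡-Reasoning

≡just⇒Is-just : ∀ {A : Set} {m : Maybe A} {x} → m ≡ just x → Is-just m
≡just⇒Is-just refl = just tt

Is-just⇒≡just : ∀ {A : Set} {m : Maybe A} → Is-just m → ∃ λ x → m ≡ just x
Is-just⇒≡just (just {x = x} _) = x , refl

module Footprints (SA : SepAlg) where
  open SepAlg SA
  open SA-Defs SA
  open Equivalence

  ≐-refl : ∀ {P} → P ≐ P
  ≐-refl x = ⇔-id _

  ≐-sym : ∀ {P Q} → P ≐ Q → Q ≐ P
  ≐-sym P≐Q x = ⇔-sym (P≐Q x)

  ≐-trans : ∀ {P Q R} → P ≐ Q → Q ≐ R → P ≐ R
  ≐-trans P≐Q Q≐R x = Q≐R x ⇔-∘ P≐Q x

  -- a ≈ b unfolds to  δ b a,  i.e. a ∈ δ(b).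
  _≈_ : St → St → Set
  a ≈ b = ∀ c → Is-just (a ⊙ c) ⇔ Is-just (b ⊙ c)

  ≈-sym : ∀ {a b} → a ≈ b → b ≈ a
  ≈-sym a≈b c = ⇔-sym (a≈b c)

  ≈-trans : ∀ {a b d} → a ≈ b → b ≈ d → a ≈ d
  ≈-trans a≈b b≈d c = b≈d c ⇔-∘ a≈b c

  δ≐⇒≈ : ∀ {a b} → δ a ≐ δ b → a ≈ b
  δ≐⇒≈ {a} δa≐δb = to (δa≐δb a) (λ c → ⇔-id _)

  ≈⇒δ≐ : ∀ {a b} → a ≈ b → δ a ≐ δ b
  ≈⇒δ≐ a≈b x = mk⇔ (λ x≈a → ≈-trans x≈a a≈b) (λ x≈b → ≈-trans x≈b (≈-sym a≈b))

  ⊙-defined-comm : ∀ {a b} → Is-just (a ⊙ b) → Is-just (b ⊙ a)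
  ⊙-defined-comm {a} {b} = subst Is-just (comm a b)

  ⊙-defined-resp-≈ : ∀ {a a' b b'} → a ≈ a' → b ≈ b' → Is-just (a ⊙ b) → Is-just (a' ⊙ b')
  ⊙-defined-resp-≈ {a' = a'} {b = b} a≈a' b≈b' =
    ⊙-defined-comm ∘ to (b≈b' a') ∘ ⊙-defined-comm ∘ to (a≈a' b)

  assoc-just : ∀ {a b c ab bc} → a ⊙ b ≡ just ab → b ⊙ c ≡ just bc → ab ⊙ c ≡ a ⊙ bc
  assoc-just {a} {b} {c} {ab} {bc} ab≡ bc≡ = begin
    ab ⊙ c                 ≡⟨ cong (_>>= (_⊙ c)) ab≡ ⟨
    ((a ⊙ b) >>= (_⊙ c))   ≡⟨ assoc a b c ⟩
    ((b ⊙ c) >>= (a ⊙_))   ≡⟨ cong (_>>= (a ⊙_)) bc≡ ⟩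
    a ⊙ bc                 ∎

  Defined₃ : St → St → St → Set
  Defined₃ a b c = Is-just ((a ⊙ b) >>= (_⊙ c))

  defined₃-comm : ∀ {a b c} → Defined₃ a b c → Defined₃ b a c
  defined₃-comm {a} {b} {c} = subst (λ ab → Is-just (ab >>= (_⊙ c))) (comm a b)

  defined₃-resp-≈ : ∀ {a a' b c} → a ≈ a' → Defined₃ a b c → Defined₃ a' b c
  defined₃-resp-≈ {a} {a'} {b} {c} a≈a' =
    subst Is-just (sym (assoc a' b c)) ∘ frame (b ⊙ c) ∘ subst Is-just (assoc a b c)
    where
    frame : ∀ m → Is-just (m >>= (a ⊙_)) → Is-just (m >>= (a' ⊙_))
    frame (just bc) = to (a≈a' bc)

  ⊙-resp-≈ : ∀ {a a' b b' s s'} → a ≈ a' → b ≈ b' → a ⊙ b ≡ just s → a' ⊙ b' ≡ just s' → s ≈ s'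
  ⊙-resp-≈ a≈a' b≈b' ab≡s a'b'≡s' c =
    mk⇔ (transport a≈a' b≈b' ab≡s a'b'≡s') (transport (≈-sym a≈a') (≈-sym b≈b') a'b'≡s' ab≡s)
    where
    -- Inside (a * b) * c, replace a by a' and then b by b', commuting so the replaced factor is in front.
    transport : ∀ {a a' b b' s s'} → a ≈ a' → b ≈ b' → a ⊙ b ≡ just s → a' ⊙ b' ≡ just s' →
                Is-just (s ⊙ c) → Is-just (s' ⊙ c)
    transport a≈a' b≈b' ab≡s a'b'≡s' =
      subst (λ m → Is-just (m >>= (_⊙ c))) a'b'≡s'
      ∘ defined₃-comm ∘ defined₃-resp-≈ b≈b' ∘ defined₃-comm ∘ defined₃-resp-≈ a≈a'
      ∘ subst (λ m → Is-just (m >>= (_⊙ c))) (sym ab≡s)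

  fpCompose-defined : ∀ {l σp l' σ} → FpCompose l σp l' → l ≐ δ σ → Is-just (σ ⊙ σp)
  fpCompose-defined (_ , _ , _ , l≐δx₁ , δσp≐δx₂ , x₁x₂≡s , _) l≐δσ =
    ⊙-defined-resp-≈ (δ≐⇒≈ (≐-trans (≐-sym l≐δx₁) l≐δσ)) (δ≐⇒≈ (≐-sym δσp≐δx₂))
                     (≡just⇒Is-just x₁x₂≡s)

  fpCompose-⊙ : ∀ {l σp l' σ σ'} → FpCompose l σp l' → l ≐ δ σ → σ ⊙ σp ≡ just σ' → l' ≐ δ σ'
  fpCompose-⊙ (_ , _ , _ , l≐δx₁ , δσp≐δx₂ , x₁x₂≡s , l'≐δs) l≐δσ σσp≡σ' =
    ≐-trans l'≐δs (≈⇒δ≐ (⊙-resp-≈ (δ≐⇒≈ (≐-trans (≐-sym l≐δx₁) l≐δσ)) (δ≐⇒≈ (≐-sym δσp≐δx₂))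
                                  x₁x₂≡s σσp≡σ'))

  fpMinus-⊙ : FpCancellative → ∀ {l σq l' σ σ'} →
              FpMinus l σq l' → l ≐ δ σ → σq ⊙ σ' ≡ just σ → l' ≐ δ σ'
  fpMinus-⊙ fpc {σq = σq} {σ = σ} {σ' = σ'} (u , v , w , δσq≐δu , l≐δv , uw≡v , l'≐δw) l≐δσ σqσ'≡σ =
    ≐-trans l'≐δw (fpc u w v σq σ' σ uw≡v σqσ'≡σ (≐-trans (≐-sym l≐δv) l≐δσ) (≐-sym δσq≐δu))

module CallReturnCommutation (SA : SepAlg) (T : Set) (_≟T_ : DecidableEquality T) (M : Set)
         (PC : Prims SA T) (L : M → Com (Prims.Cmd PC)) (Γ : M → Triple SA T) where
  open SepAlg SA
  open SA-Defs SA
  open Semantics SA T _≟T_ M PC L Γ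
  open Prims PC
  open Footprints SA

  history-++ : ∀ ζ ζ' → history (ζ ++ ζ') ≡ history ζ ++ history ζ'
  history-++ []                  ζ' = refl
  history-++ (acmd _ _ ∷ ζ)      ζ' = history-++ ζ ζ'
  history-++ (acall t m σ ∷ ζ)   ζ' = cong (hcall t m σ ∷_) (history-++ ζ ζ')
  history-++ (aret t m σ ∷ ζ)    ζ' = cong (hret t m σ ∷_) (history-++ ζ ζ')

  run-++⁻ : ∀ ζ {ζ' σ τ σ'} → Run σ τ (ζ ++ ζ') σ' →
            ∃ λ τ₁ → ∃ λ τ₂ → ∃ λ ρ → τ ≡ τ₁ ++ τ₂ × Run σ τ₁ ζ ρ × Run ρ τ₂ ζ' σ'
  run-++⁻ []      run                = [] , _ , _ , refl , r-nil , run
  run-++⁻ (_ ∷ ζ) (r-cons step run) with run-++⁻ ζ run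
  ... | τ₁ , τ₂ , ρ , refl , run₁ , run₂ = _ ∷ τ₁ , τ₂ , ρ , refl , r-cons step run₁ , run₂

  run-++⁺ : ∀ {σ τ₁ ζ ρ τ₂ ζ' σ'} → Run σ τ₁ ζ ρ → Run ρ τ₂ ζ' σ' → Run σ (τ₁ ++ τ₂) (ζ ++ ζ') σ'
  run-++⁺ r-nil              run₂ = run₂
  run-++⁺ (r-cons step run₁) run₂ = r-cons step (run-++⁺ run₁ run₂)

  cmd-preserves-δ : ∀ {σ σ' t c} → σ' ∈out f t c σ → δ σ' ≐ δ σ
  cmd-preserves-δ {σ} {σ'} {t} {c} σ'∈ with f t c σ in eq
  ... | outs P = fp-pres t c σ P σ' eq σ'∈

  run-tracks-footprint : FpCancellative → ∀ {σ τ ζ ρ H l l''} → Run σ τ ζ ρ →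
                         FpEval (history ζ ++ H) l l'' → l ≐ δ σ →
                         ∃ λ l' → FpEval H l' l'' × l' ≐ δ ρ
  run-tracks-footprint fpc r-nil fe l≐δσ = _ , fe , l≐δσ
  run-tracks-footprint fpc (r-cons (s-cmd σ'∈) run) fe l≐δσ =
    run-tracks-footprint fpc run fe (≐-trans l≐δσ (≐-sym (cmd-preserves-δ σ'∈)))
  run-tracks-footprint fpc (r-cons (s-call _ σσp≡σ') run) (fe-call comp fe) l≐δσ =
    run-tracks-footprint fpc run fe (fpCompose-⊙ comp l≐δσ σσp≡σ')
  run-tracks-footprint fpc (r-cons (s-ret _ σqσ'≡σ) run) (fe-ret minus fe) l≐δσ =
    run-tracks-footprint fpc run fe (fpMinus-⊙ fpc minus l≐δσ σqσ'≡σ)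

  balanced-call-defined : FpCancellative → ∀ {σ₀ τ ζ ρ t m σ ζ'} → Run σ₀ τ ζ ρ →
                          BalancedFrom (history (ζ ++ acall t m σ ∷ ζ')) (δ σ₀) →
                          ∃ λ x → ρ ⊙ σ ≡ just x
  balanced-call-defined fpc {σ₀} {ζ = ζ} run (_ , fe)
    with run-tracks-footprint fpc run (subst (λ H → FpEval H (δ σ₀) _) (history-++ ζ _) fe) ≐-refl
  ... | _ , fe-call comp _ , l≐δρ = Is-just⇒≡just (fpCompose-defined comp l≐δρ)

  ret-call-commute : ∀ {ρ ρ' ρ'' x t₁ t₂ m₁ m₂ σ₁ σ₂} →
                     Step ρ (ret t₂ m₂) ρ' (aret t₂ m₂ σ₂) → Step ρ' (call t₁ m₁) ρ'' (acall t₁ m₁ σ₁) →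
                     ρ ⊙ σ₁ ≡ just x →
                     Step ρ (call t₁ m₁) x (acall t₁ m₁ σ₁) × Step x (ret t₂ m₂) ρ'' (aret t₂ m₂ σ₂)
  ret-call-commute (s-ret q σ₂ρ'≡ρ) (s-call p ρ'σ₁≡ρ'') ρσ₁≡x =
    s-call p ρσ₁≡x , s-ret q (trans (sym (assoc-just σ₂ρ'≡ρ ρ'σ₁≡ρ'')) ρσ₁≡x)

  proj-++ : ∀ t τ τ' → proj t (τ ++ τ') ≡ proj t τ ++ proj t τ'
  proj-++ t = filter-++ (λ a → thr a ≟T t)

  proj-∷-own : ∀ {t a} τ → thr a ≡ t → proj t (a ∷ τ) ≡ a ∷ proj t τ
  proj-∷-own {t} _ = filter-accept (λ a → thr a ≟T t)

  hproj-++ : ∀ t H H' → hproj t (H ++ H') ≡ hproj t H ++ hproj t H'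
  hproj-++ t = filter-++ (λ a → hthr a ≟T t)

  hproj-∷-own : ∀ {t a} H → hthr a ≡ t → hproj t (a ∷ H) ≡ a ∷ hproj t H
  hproj-∷-own {t} _ = filter-accept (λ a → hthr a ≟T t)

  proj-singletons-comm : ∀ t {a b} → thr a ≢ thr b →
                         proj t [ a ] ++ proj t [ b ] ≡ proj t [ b ] ++ proj t [ a ]
  proj-singletons-comm t {a} {b} a≢b with thr a ≟T t | thr b ≟T t
  ... | yes a≡t | yes b≡t = ⊥-elim (a≢b (trans a≡t (sym b≡t)))
  ... | yes _   | no _    = refl
  ... | no _    | yes _   = refl
  ... | no _    | no _    = refl

  proj-swap : ∀ t {a b} τ → thr a ≢ thr b → proj t (a ∷ b ∷ τ) ≡ proj t (b ∷ a ∷ τ)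
  proj-swap t {a} {b} τ a≢b = begin
    proj t (a ∷ b ∷ τ)                          ≡⟨ proj-++ t [ a ] _ ⟩
    proj t [ a ] ++ proj t (b ∷ τ)              ≡⟨ cong (proj t [ a ] ++_) (proj-++ t [ b ] τ) ⟩
    proj t [ a ] ++ proj t [ b ] ++ proj t τ    ≡⟨ ++-assoc (proj t [ a ]) _ _ ⟨
    (proj t [ a ] ++ proj t [ b ]) ++ proj t τ  ≡⟨ cong (_++ proj t τ) (proj-singletons-comm t a≢b) ⟩
    (proj t [ b ] ++ proj t [ a ]) ++ proj t τ  ≡⟨ ++-assoc (proj t [ b ]) _ _ ⟩
    proj t [ b ] ++ proj t [ a ] ++ proj t τ    ≡⟨ cong (proj t [ b ] ++_) (proj-++ t [ a ] τ) ⟨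
    proj t [ b ] ++ proj t (a ∷ τ)              ≡⟨ proj-++ t [ b ] _ ⟨
    proj t (b ∷ a ∷ τ)                          ∎

  trace-swap : ∀ {τ a b τ'} → thr a ≢ thr b → Trace (τ ++ a ∷ b ∷ τ') → Trace (τ ++ b ∷ a ∷ τ')
  trace-swap {τ} {a} {b} {τ'} a≢b (_ , s , refl , blocks) =
    _ , s , refl , λ t → subst (Blocks t) (swapped t) (blocks t)
    where
    swapped : ∀ t → proj t ((τ ++ a ∷ b ∷ τ') ++ s) ≡ proj t ((τ ++ b ∷ a ∷ τ') ++ s)
    swapped t = begin
      proj t ((τ ++ a ∷ b ∷ τ') ++ s)          ≡⟨ cong (proj t) (++-assoc τ _ s) ⟩
      proj t (τ ++ a ∷ b ∷ τ' ++ s)            ≡⟨ proj-++ t τ _ ⟩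
      proj t τ ++ proj t (a ∷ b ∷ τ' ++ s)     ≡⟨ cong (proj t τ ++_) (proj-swap t (τ' ++ s) a≢b) ⟩
      proj t τ ++ proj t (b ∷ a ∷ τ' ++ s)     ≡⟨ proj-++ t τ _ ⟨
      proj t (τ ++ b ∷ a ∷ τ' ++ s)            ≡⟨ cong (proj t) (++-assoc τ _ s) ⟨
      proj t ((τ ++ b ∷ a ∷ τ') ++ s)          ∎

  data Kind : Set where
    kcall kret : Kind

  data Status : Set where
    idle busy : Status

  kinds : List Act → List Kind
  kinds []              = []
  kinds (cmd _ _ ∷ τ)   = kinds τ
  kinds (call _ _ ∷ τ)  = kcall ∷ kinds τ
  kinds (ret _ _ ∷ τ)   = kret ∷ kinds τ

  hkinds : List HAct → List Kind
  hkinds []                = []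
  hkinds (hcall _ _ _ ∷ H) = kcall ∷ hkinds H
  hkinds (hret _ _ _ ∷ H)  = kret ∷ hkinds H

  advance : Status → Kind → Maybe Status
  advance idle kcall = just busy
  advance busy kret  = just idle
  advance _    _     = nothing

  advance* : Status → List Kind → Maybe Status
  advance* s []       = just s
  advance* s (k ∷ ks) = advance s k >>= λ s' → advance* s' ks

  expects : Kind → Status
  expects kcall = idle
  expects kret  = busy

  advance*-before : ∀ s ks k ks' → Is-just (advance* s (ks ++ k ∷ ks')) → advance* s ks ≡ just (expects k)
  advance*-before idle []        kcall _   _ = refl
  advance*-before busy []        kret  _   _ = refl
  advance*-before s    (k₀ ∷ ks) k     ks' d with advance s k₀
  ... | just s' = advance*-before s' ks k ks' d

  kinds-++ : ∀ τ τ' → kinds (τ ++ τ') ≡ kinds τ ++ kinds τ'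
  kinds-++ []             τ' = refl
  kinds-++ (cmd _ _ ∷ τ)  τ' = kinds-++ τ τ'
  kinds-++ (call _ _ ∷ τ) τ' = cong (kcall ∷_) (kinds-++ τ τ')
  kinds-++ (ret _ _ ∷ τ)  τ' = cong (kret ∷_) (kinds-++ τ τ')

  hkinds-++ : ∀ H H' → hkinds (H ++ H') ≡ hkinds H ++ hkinds H'
  hkinds-++ []                H' = refl
  hkinds-++ (hcall _ _ _ ∷ H) H' = cong (kcall ∷_) (hkinds-++ H H')
  hkinds-++ (hret _ _ _ ∷ H)  H' = cong (kret ∷_) (hkinds-++ H H')

  kinds-cmds : ∀ t cs τ → kinds (map (cmd t) cs ++ τ) ≡ kinds τ
  kinds-cmds t []       τ = refl
  kinds-cmds t (_ ∷ cs) τ = kinds-cmds t cs τ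

  blocks-alternate : ∀ {t τ} → Blocks t τ → advance* idle (kinds τ) ≡ just idle
  blocks-alternate b-nil = refl
  blocks-alternate {t} (b-cons {m} {cs} {rest} _ b) =
    trans (cong (advance* busy) (kinds-cmds t cs (ret t m ∷ rest))) (blocks-alternate b)

  threadWF-alternate : ∀ {t H} → ThreadWF t H → Is-just (advance* idle (hkinds H))
  threadWF-alternate w-nil      = just tt
  threadWF-alternate w-pending  = just tt
  threadWF-alternate (w-cons w) = threadWF-alternate w

  run-kinds : ∀ t {σ τ ζ σ'} → Run σ τ ζ σ' → hkinds (hproj t (history ζ)) ≡ kinds (proj t τ)
  run-kinds t r-nil = refl
  run-kinds t (r-cons (s-cmd {t = t'} _) run) with t' ≟T t
  ... | yes _ = run-kinds t run
  ... | no _  = run-kinds t run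
  run-kinds t (r-cons (s-call {t = t'} _ _) run) with t' ≟T t
  ... | yes _ = cong (kcall ∷_) (run-kinds t run)
  ... | no _  = run-kinds t run
  run-kinds t (r-cons (s-ret {t = t'} _ _) run) with t' ≟T t
  ... | yes _ = cong (kret ∷_) (run-kinds t run)
  ... | no _  = run-kinds t run

  trace-busy-before-ret : ∀ {τ t m τ'} → Trace (τ ++ ret t m ∷ τ') →
                          advance* idle (kinds (proj t τ)) ≡ just busy
  trace-busy-before-ret {τ} {t} {m} {τ'} (_ , s , refl , blocks) =
    advance*-before idle (kinds (proj t τ)) kret _
      (subst (Is-just ∘ advance* idle) split (≡just⇒Is-just (blocks-alternate (blocks t))))
    where
    split : kinds (proj t ((τ ++ ret t m ∷ τ') ++ s)) ≡
            kinds (proj t τ) ++ kret ∷ kinds (proj t (τ' ++ s))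
    split = begin
      kinds (proj t ((τ ++ ret t m ∷ τ') ++ s))         ≡⟨ cong (kinds ∘ proj t) (++-assoc τ _ s) ⟩
      kinds (proj t (τ ++ ret t m ∷ τ' ++ s))           ≡⟨ cong kinds (proj-++ t τ _) ⟩
      kinds (proj t τ ++ proj t (ret t m ∷ τ' ++ s))    ≡⟨ cong (kinds ∘ (proj t τ ++_)) (proj-∷-own (τ' ++ s) refl) ⟩
      kinds (proj t τ ++ ret t m ∷ proj t (τ' ++ s))    ≡⟨ kinds-++ (proj t τ) _ ⟩
      kinds (proj t τ) ++ kret ∷ kinds (proj t (τ' ++ s)) ∎

  history-idle-before-call : ∀ {H t m σ H'} → IsHistory (H ++ hcall t m σ ∷ H') →
                             advance* idle (hkinds (hproj t H)) ≡ just idle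
  history-idle-before-call {H} {t} {m} {σ} {H'} wf =
    advance*-before idle (hkinds (hproj t H)) kcall _
      (subst (Is-just ∘ advance* idle) split (threadWF-alternate (wf t)))
    where
    split : hkinds (hproj t (H ++ hcall t m σ ∷ H')) ≡
            hkinds (hproj t H) ++ kcall ∷ hkinds (hproj t H')
    split = begin
      hkinds (hproj t (H ++ hcall t m σ ∷ H'))          ≡⟨ cong hkinds (hproj-++ t H _) ⟩
      hkinds (hproj t H ++ hproj t (hcall t m σ ∷ H'))  ≡⟨ cong (hkinds ∘ (hproj t H ++_)) (hproj-∷-own H' refl) ⟩
      hkinds (hproj t H ++ hcall t m σ ∷ hproj t H')    ≡⟨ hkinds-++ (hproj t H) _ ⟩
      hkinds (hproj t H) ++ kcall ∷ hkinds (hproj t H') ∎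

  ret-in-trace-call-in-history-distinct : ∀ {σ τ ζ ρ t₁ t₂ m₁ m₂ σ₁ τ' ζ'} →
    Trace (τ ++ ret t₂ m₂ ∷ τ') → Run σ τ ζ ρ → IsHistory (history (ζ ++ acall t₁ m₁ σ₁ ∷ ζ')) → t₂ ≢ t₁
  ret-in-trace-call-in-history-distinct {τ = τ} {ζ} {t₁ = t} tr run wf refl =
    idle≢busy (just-injective (begin
      just idle                                     ≡⟨ idle-before-call ⟨
      advance* idle (hkinds (hproj t (history ζ)))  ≡⟨ cong (advance* idle) (run-kinds t run) ⟩
      advance* idle (kinds (proj t τ))              ≡⟨ trace-busy-before-ret tr ⟩
      just busy                                     ∎))
    where
    idle-before-call : advance* idle (hkinds (hproj t (history ζ))) ≡ just idle
    idle-before-call = history-idle-before-call {H = history ζ} (subst IsHistory (history-++ ζ _) wf)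

    idle≢busy : idle ≢ busy
    idle≢busy ()

  swap-ret-call : FpCancellative → ∀ {σ₀ ζ₁ ζ₂ t₁ t₂ m₁ m₂ σ₁ σ₂} →
                  InSem σ₀ (ζ₁ ++ (aret t₂ m₂ σ₂ ∷ acall t₁ m₁ σ₁ ∷ ζ₂)) →
                  IsHistory (history (ζ₁ ++ (acall t₁ m₁ σ₁ ∷ aret t₂ m₂ σ₂ ∷ ζ₂))) →
                  BalancedFrom (history (ζ₁ ++ (acall t₁ m₁ σ₁ ∷ aret t₂ m₂ σ₂ ∷ ζ₂))) (δ σ₀) →
                  InSem σ₀ (ζ₁ ++ (acall t₁ m₁ σ₁ ∷ aret t₂ m₂ σ₂ ∷ ζ₂))
  swap-ret-call fpc {ζ₁ = ζ₁} (_ , σ' , tr , run) wf bal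
    with run-++⁻ ζ₁ run
  ... | _ , _ , _ , refl , run₁ , r-cons ret-step@(s-ret _ _) (r-cons call-step@(s-call _ _) run₂) =
    let _ , ρσ₁≡x              = balanced-call-defined fpc run₁ bal
        call-step' , ret-step' = ret-call-commute ret-step call-step ρσ₁≡x
    in  _ , σ' , trace-swap (ret-in-trace-call-in-history-distinct tr run₁ wf) tr ,
        run-++⁺ run₁ (r-cons call-step' (r-cons ret-step' run₂))

proposition7p3 : (SA : SepAlg) (T : Set) (_≟T_ : DecidableEquality T) (M : Set)
    (PC : Prims SA T) (L : M → Com (Prims.Cmd PC)) (Γ : M → Triple SA T) →
    SA-Defs.FpCancellative SA →
    let open SepAlg SA
        open SA-Defs SA
        open Semantics SA T _≟T_ M PC L Γ
    in ∀ (σ₀ : St) (ζ₁ ζ₂ : List AAct) (t₁ t₂ : T) (m₁ m₂ : M) (σ₁ σ₂ : St) →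
       Safe σ₀ →
       InSem σ₀ (ζ₁ ++ (aret t₂ m₂ σ₂ ∷ acall t₁ m₁ σ₁ ∷ ζ₂)) →
       IsHistory (history (ζ₁ ++ (acall t₁ m₁ σ₁ ∷ aret t₂ m₂ σ₂ ∷ ζ₂))) →
       BalancedFrom (history (ζ₁ ++ (acall t₁ m₁ σ₁ ∷ aret t₂ m₂ σ₂ ∷ ζ₂))) (δ σ₀) →
       InSem σ₀ (ζ₁ ++ (acall t₁ m₁ σ₁ ∷ aret t₂ m₂ σ₂ ∷ ζ₂))
proposition7p3 SA T _≟T_ M PC L Γ fpc _ _ _ _ _ _ _ _ _ _ = swap-ret-call fpc
  where open CallReturnCommutation SA T _≟T_ M PC L Γ
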